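{- Up to projective equivalence, the minimal 1-saturating sets in $\mathrm{PG}(3,2)$ are exactly the following four sets: the complete $5$-cap $\{1,2,4,8,15\}$ with stabilizer group $S_5$; the $6$-set $\{1,2,3,4,8,12\}$ (containing three collinear points) with stabilizer group $(S_3\times S_3)\rtimes C_2$ of order $72$; the complete $8$-cap $\{1,2,4,7,8,11,13,14\}$ with stabilizer group $ASL(3,2)$ of order $1344$; and the $8$-set $\{1,2,4,5,8,9,12,13\}$ (containing three collinear points) with stabilizer group $PSL(3,2)$ of order $168$. In particular the possible sizes of minimal 1-saturating sets in $\mathrm{PG}(3,2)$ are $5$, $6$ and $8$.
   Context: Points of $\mathrm{PG}(v,2)$ are identified with nonzero vectors of $\mathbb{F}_2^{v+1}$, and a point is denoted by the decimal integer whose binary representation is its coordinate vector. Three distinct points $x,y,z$ are collinear iff $x+y+z=0$ (bitwise XOR). A set $S\subseteq \mathrm{PG}(v,2)$ is 1-saturating if $S\neq\mathrm{PG}(v,2)$ and every point of $\mathrm{PG}(v,2)\setminus S$ equals $x+y$ for some distinct $x,y\in S$. A 1-saturating $k$-set is minimal if it contains no 1-saturating set of $k-1$ points. A cap is a set with no three collinear points; it is complete if not contained in a larger cap. Projective equivalence is with respect to $PGL(v+1,2)$; the stabilizer group is the subgroup of $PGL(v+1,2)$ fixing the set. -}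

module Defs where

open import Data.Bool using (Bool; true; false; _∧_; _xor_; if_then_else_)
open import Data.Nat using (ℕ; zero; suc; _≡ᵇ_; _/_; _%_)
open import Data.Fin using (Fin; toℕ)
open import Data.Fin.Properties using (_≟_)
open import Data.Fin.Subset using (Subset; _∈_; _∉_; _⊆_; ⊤)
open import Data.Vec using (Vec; []; _∷_; map; zipWith; foldr; replicate; transpose; tabulate)
open import Data.List using (List)
open import Data.Bool.ListAction using (any)
open import Data.Product using (Σ; _×_; ∃; ∃-syntax; _,_)
open import Function using (_∘_; Injective)
open import Relation.Nullary using (¬_; ⌊_⌋)
open import Relation.Binary.PropositionalEquality using (_≡_; _≢_)

Vecₖ : ℕ → Set
Vecₖ n = Vec Bool n

_⊕_ : {n : ℕ} → Vecₖ n → Vecₖ n → Vecₖ n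
_⊕_ = zipWith _xor_

𝟎 : {n : ℕ} → Vecₖ n
𝟎 = replicate _ false

dot : {n : ℕ} → Vecₖ n → Vecₖ n → Bool
dot r v = foldr _ _xor_ false (zipWith _∧_ r v)

-- n × n matrices over F₂, given as a vector of rows
Mat : ℕ → Set
Mat n = Vec (Vecₖ n) n

_·ᵥ_ : {n : ℕ} → Mat n → Vecₖ n → Vecₖ n
M ·ᵥ v = map (λ r → dot r v) M

_*ₘ_ : {n : ℕ} → Mat n → Mat n → Mat n
M *ₘ N = map (λ r → map (dot r) (transpose N)) M

Iₘ : (n : ℕ) → Mat n
Iₘ n = tabulate (λ i → tabulate (λ j → ⌊ i ≟ j ⌋))

IsGL : {n : ℕ} → Mat n → Set
IsGL {n} M = Σ (Mat n) λ N → (M *ₘ N ≡ Iₘ n) × (N *ₘ M ≡ Iₘ n)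

-- determinant of a 3 × 3 matrix over F₂ (Sarrus / Leibniz formula; signs vanish)
det₃ : Mat 3 → Bool
det₃ ((a ∷ b ∷ c ∷ []) ∷ (d ∷ e ∷ f ∷ []) ∷ (g ∷ h ∷ i ∷ []) ∷ []) =
  (a ∧ e ∧ i) xor (b ∧ f ∧ g) xor (c ∧ d ∧ h)
    xor (c ∧ e ∧ g) xor (b ∧ d ∧ i) xor (a ∧ f ∧ h)

-- The point with index i : Fin 15 is the point
-- denoted by the decimal integer toℕ i + 1, i.e. its coordinate vector
-- is the binary representation of toℕ i + 1 (least significant bit first).

bits : (k : ℕ) → ℕ → Vecₖ k
bits zero    n = []
bits (suc k) n = (n % 2 ≡ᵇ 1) ∷ bits k (n / 2)

Point : Set
Point = Fin 15

pt : Point → Vecₖ 4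
pt i = bits 4 (suc (toℕ i))

⟦_⟧ : List ℕ → Subset 15
⟦ xs ⟧ = tabulate (λ i → any (λ x → x ≡ᵇ suc (toℕ i)) xs)

Collinear : Point → Point → Point → Set
Collinear x y z = x ≢ y × y ≢ z × x ≢ z × (pt x ⊕ pt y) ⊕ pt z ≡ 𝟎

Saturating1 : Subset 15 → Set
Saturating1 S =
  S ≢ ⊤ ×
  (∀ p → p ∉ S → ∃[ x ] ∃[ y ] (x ∈ S × y ∈ S × x ≢ y × pt p ≡ pt x ⊕ pt y))

MinimalSaturating1 : Subset 15 → Set
MinimalSaturating1 S =
  Saturating1 S ×
  (∀ T → T ⊆ S → suc (Data.Fin.Subset.∣ T ∣) ≡ Data.Fin.Subset.∣ S ∣ → ¬ Saturating1 T)

HasCollinearTriple : Subset 15 → Set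
HasCollinearTriple S = ∃[ x ] ∃[ y ] ∃[ z ] (x ∈ S × y ∈ S × z ∈ S × Collinear x y z)

IsCap : Subset 15 → Set
IsCap S = ¬ HasCollinearTriple S

IsCompleteCap : Subset 15 → Set
IsCompleteCap S = IsCap S × (∀ T → S ⊆ T → T ≢ S → ¬ IsCap T)

-- Projective equivalence.  Over F₂ the only nonzero scalar is 1, so
-- PGL(4,2) = GL(4,2) acting on nonzero vectors.

MapsOnto : Mat 4 → Subset 15 → Subset 15 → Set
MapsOnto M S T = ∀ p q → pt q ≡ M ·ᵥ pt p → (p ∈ S → q ∈ T) × (q ∈ T → p ∈ S)

ProjEquiv : Subset 15 → Subset 15 → Set
ProjEquiv S T = Σ (Mat 4) λ M → IsGL M × MapsOnto M S T

InStab : Subset 15 → Mat 4 → Set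
InStab S M = IsGL M × MapsOnto M S S

-- Concrete groups and isomorphism with a stabilizer.
-- A concrete group: carrier, membership predicate (the group is the
-- subset of members), operation and equality of elements.

record ConcreteGroup : Set₁ where
  field
    Carrier : Set
    Mem     : Carrier → Set
    _∙_     : Carrier → Carrier → Carrier
    _≈_     : Carrier → Carrier → Set

record StabIso (S : Subset 15) (G : ConcreteGroup) : Set where
  open ConcreteGroup G
  field
    to       : Mat 4 → Carrier
    to-mem   : ∀ M → InStab S M → Mem (to M)
    to-hom   : ∀ M N → InStab S M → InStab S N → to (M *ₘ N) ≈ (to M ∙ to N)
    to-inj   : ∀ M N → InStab S M → InStab S N → to M ≈ to N → M ≡ N
    to-surj  : ∀ g → Mem g → ∃[ M ] (InStab S M × to M ≈ g)

Sym5 : ConcreteGroup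
Sym5 = record
  { Carrier = Fin 5 → Fin 5
  ; Mem     = Injective _≡_ _≡_
  ; _∙_     = λ f g → f ∘ g
  ; _≈_     = λ f g → ∀ i → f i ≡ g i
  }

-- (S₃ × S₃) ⋊ C₂, C₂ = Bool acting by swapping the two factors
-- (the wreath product S₃ ≀ C₂):
--   ((σ₁,σ₂),e) · ((τ₁,τ₂),f) = ((σ₁,σ₂)·e(τ₁,τ₂), e + f)
S3xS3⋊C2 : ConcreteGroup
S3xS3⋊C2 = record
  { Carrier = ((Fin 3 → Fin 3) × (Fin 3 → Fin 3)) × Bool
  ; Mem     = λ { ((σ₁ , σ₂) , _) → Injective _≡_ _≡_ σ₁ × Injective _≡_ _≡_ σ₂ }
  ; _∙_     = λ { ((σ₁ , σ₂) , e) ((τ₁ , τ₂) , f) →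
                  ((σ₁ ∘ (if e then τ₂ else τ₁)) , (σ₂ ∘ (if e then τ₁ else τ₂))) , (e xor f) }
  ; _≈_     = λ { ((σ₁ , σ₂) , e) ((τ₁ , τ₂) , f) →
                  (∀ i → σ₁ i ≡ τ₁ i) × (∀ i → σ₂ i ≡ τ₂ i) × e ≡ f }
  }

-- ASL(3,2): affine maps x ↦ A x + b with A ∈ SL(3,2), b ∈ F₂³, under composition
ASL32 : ConcreteGroup
ASL32 = record
  { Carrier = Mat 3 × Vecₖ 3
  ; Mem     = λ { (A , _) → det₃ A ≡ true }
  ; _∙_     = λ { (A , b) (C , d) → (A *ₘ C) , ((A ·ᵥ d) ⊕ b) }
  ; _≈_     = _≡_
  }

-- PSL(3,2) = SL(3,2) / {scalar matrices of det 1}; over F₂ the only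
-- scalar matrix is the identity, so PSL(3,2) is SL(3,2) itself.
PSL32 : ConcreteGroup
PSL32 = record
  { Carrier = Mat 3
  ; Mem     = λ A → det₃ A ≡ true
  ; _∙_     = _*ₘ_
  ; _≈_     = _≡_
  }

K5 : Subset 15
K5 = ⟦ 1 List.∷ 2 List.∷ 4 List.∷ 8 List.∷ 15 List.∷ List.[] ⟧
  where import Data.List as List

K6 : Subset 15
K6 = ⟦ 1 List.∷ 2 List.∷ 3 List.∷ 4 List.∷ 8 List.∷ 12 List.∷ List.[] ⟧
  where import Data.List as List

K8a : Subset 15
K8a = ⟦ 1 List.∷ 2 List.∷ 4 List.∷ 7 List.∷ 8 List.∷ 11 List.∷ 13 List.∷ 14 List.∷ List.[] ⟧
  where import Data.List as List

K8b : Subset 15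
K8b = ⟦ 1 List.∷ 2 List.∷ 4 List.∷ 5 List.∷ 8 List.∷ 9 List.∷ 12 List.∷ 13 List.∷ List.[] ⟧
  where import Data.List as List

rep : Fin 4 → Subset 15
rep Fin.zero = K5
rep (Fin.suc Fin.zero) = K6
rep (Fin.suc (Fin.suc Fin.zero)) = K8a
rep (Fin.suc (Fin.suc (Fin.suc Fin.zero))) = K8b

-- Adding points to a
-- 1-saturating set keeps it 1-saturating, so a saturating set is minimal
-- iff no single point can be removed, and the minimal sets are found by
-- checking all 2¹⁵ subsets.  A projectivity is determined by the images of
-- the frame 1, 2, 4, 8, which lies in every representative; so the
-- equivalences onto a given set, and the stabilisers, are found among the
-- frames of points of that set.  Each stabiliser is identified with its
-- group through an action on a set of vectors (the five points of K5, the
-- two lines of K6, the affine space K8a, the plane of K8b plus one point),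
-- checked on representatives of the group elements.
module Submission where

open import Defs
open import Algebra.Bundles using (CommutativeRing)
open import Data.Bool using (Bool; true; false; _∧_; _∨_; _xor_; not; T; if_then_else_)
open import Data.Bool.Properties
  using (T-∧; T-∨; T-≡; T-not-≡; xor-assoc; xor-comm; xor-same; xor-identityʳ; xor-∧-commutativeRing;
         ∧-distribˡ-xor; ∧-distribʳ-xor; ∧-zeroʳ; ∧-identityʳ; ∧-assoc)
  renaming (_≟_ to _≟ᵇ_)
open import Data.Empty using (⊥-elim)
open import Data.Fin using (Fin; zero; suc; #_; inject₁)
open import Data.Fin.Properties using (all?; any?; ¬∀⟶∃¬) renaming (_≟_ to _≟ᶠ_)
open import Data.Fin.Subset using (Subset; _∈_; _∉_; _⊆_; ⊤; ∣_∣; _-_; ⁅_⁆; outside; inside)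
open import Data.Fin.Subset.Properties using (_∈?_; ⊆-antisym; x∈p∧x≢y⇒x∈p-y; p─⊥≡p; p─q⊆p; ∈⊤)
open import Data.Maybe using (Maybe; just; nothing; fromMaybe)
import Data.Maybe as Maybe
open import Data.Nat using (ℕ; zero; suc)
open import Data.Nat.Properties using (1+n≢n) renaming (_≟_ to _≟ℕ_)
open import Data.Product using (_×_; _,_; proj₁; proj₂; ∃; ∃-syntax; swap)
open import Data.Sum using (_⊎_; inj₁; inj₂)
open import Data.Unit using (tt)
open import Data.Vec
  using (Vec; []; _∷_; map; zipWith; replicate; transpose; tabulate; lookup; _⊛_; removeAt; here; there)
open import Data.Vec.Properties
  using (≡-dec; zipWith-assoc; zipWith-comm; zipWith-identityˡ; zipWith-identityʳ; lookup-map; lookup-zipWith;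
         tabulate-cong; tabulate∘lookup; lookup∘tabulate; map-replicate; []=⇒lookup; lookup⇒[]=)
open import Function using (_∘_; _⇔_; mk⇔; Equivalence; Injective)
open import Relation.Nullary using (Dec; yes; no; ¬_; ¬?; _⊎-dec_; _×-dec_; _→-dec_; contradiction; ⌊_⌋)
open import Relation.Nullary.Decidable using (map′; from-yes; from-no; decidable-stable; toWitness; fromWitness)
open import Relation.Binary.PropositionalEquality

open import Algebra.Properties.CommutativeSemigroup
  (CommutativeRing.+-commutativeSemigroup xor-∧-commutativeRing) using (interchange)

open Equivalence using (to; from)

private
  variable
    n m k : ℕ

-- Opaque, so that unification never normalises a check built from them;
-- the checks themselves are run below, in a block that unfolds them.
opaque
  allᵛ : Vec Bool n → Bool
  allᵛ []       = true
  allᵛ (b ∷ bs) = b ∧ allᵛ bs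

  anyᵛ : Vec Bool n → Bool
  anyᵛ []       = false
  anyᵛ (b ∷ bs) = b ∨ anyᵛ bs

  allᵛ-sound : ∀ {bs : Vec Bool n} → T (allᵛ bs) → ∀ i → T (lookup bs i)
  allᵛ-sound {bs = b ∷ bs} h zero    = proj₁ (to T-∧ h)
  allᵛ-sound {bs = b ∷ bs} h (suc i) = allᵛ-sound {bs = bs} (proj₂ (to (T-∧ {b}) h)) i

  allᵛ-complete : ∀ {bs : Vec Bool n} → (∀ i → T (lookup bs i)) → T (allᵛ bs)
  allᵛ-complete {bs = []}     h = tt
  allᵛ-complete {bs = b ∷ bs} h = from T-∧ (h zero , allᵛ-complete {bs = bs} (h ∘ suc))

  anyᵛ-sound : ∀ {bs : Vec Bool n} → T (anyᵛ bs) → ∃ λ i → T (lookup bs i)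
  anyᵛ-sound {bs = b ∷ bs} h with to (T-∨ {b}) h
  ... | inj₁ b-holds    = zero , b-holds
  ... | inj₂ some-holds = let (i , h′) = anyᵛ-sound {bs = bs} some-holds in suc i , h′

  anyᵛ-complete : ∀ {bs : Vec Bool n} i → T (lookup bs i) → T (anyᵛ bs)
  anyᵛ-complete {bs = b ∷ bs} zero    h = from T-∨ (inj₁ h)
  anyᵛ-complete {bs = b ∷ bs} (suc i) h = from (T-∨ {b}) (inj₂ (anyᵛ-complete {bs = bs} i h))

  allᶠ : ∀ n → (Fin n → Bool) → Bool
  allᶠ n p = allᵛ (tabulate p)

  anyᶠ : ∀ n → (Fin n → Bool) → Bool
  anyᶠ n p = anyᵛ (tabulate p)

  allᶠ-sound : ∀ (p : Fin n → Bool) → T (allᶠ n p) → ∀ i → T (p i)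
  allᶠ-sound p h i = subst T (lookup∘tabulate p i) (allᵛ-sound {bs = tabulate p} h i)

  allᶠ-complete : ∀ (p : Fin n → Bool) → (∀ i → T (p i)) → T (allᶠ n p)
  allᶠ-complete p h = allᵛ-complete {bs = tabulate p} λ i → subst T (sym (lookup∘tabulate p i)) (h i)

  anyᶠ-sound : ∀ (p : Fin n → Bool) → T (anyᶠ n p) → ∃ λ i → T (p i)
  anyᶠ-sound p h = let (i , h′) = anyᵛ-sound {bs = tabulate p} h in i , subst T (lookup∘tabulate p i) h′

  anyᶠ-complete : ∀ (p : Fin n → Bool) i → T (p i) → T (anyᶠ n p)
  anyᶠ-complete p i h = anyᵛ-complete {bs = tabulate p} i (subst T (sym (lookup∘tabulate p i)) h)

T-∨-elimˡ : ∀ {a b} → T (a ∨ b) → ¬ T a → T b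
T-∨-elimˡ {true}  _   ¬a = ⊥-elim (¬a tt)
T-∨-elimˡ {false} a∨b _  = a∨b

T-not⇒¬T : ∀ {a} → T (not a) → ¬ T a
T-not⇒¬T {false} _ ()

T-not-∨ : ∀ {a b} → T (not a ∨ b) → T a → T b
T-not-∨ {true} b _ = b

record Exhaustible (A : Set) : Set where
  field
    every       : (A → Bool) → Bool
    every-sound : ∀ p → T (every p) → ∀ x → T (p x)

open Exhaustible public

exhaustible-Fin : ∀ n → Exhaustible (Fin n)
exhaustible-Fin n = record { every = allᶠ n ; every-sound = allᶠ-sound }

exhaustible-Bool : Exhaustible Bool
exhaustible-Bool = record { every = λ p → p true ∧ p false ; every-sound = sound }
  where
  sound : ∀ p → T (p true ∧ p false) → ∀ b → T (p b)
  sound p h true  = proj₁ (to (T-∧ {p true}) h)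
  sound p h false = proj₂ (to (T-∧ {p true}) h)

exhaustible-× : ∀ {A B} → Exhaustible A → Exhaustible B → Exhaustible (A × B)
exhaustible-× EA EB = record
  { every       = λ p → every EA λ a → every EB λ b → p (a , b)
  ; every-sound = λ p h (a , b) → every-sound EB (λ b → p (a , b)) (every-sound EA _ h a) b
  }

exhaustible-Vec : ∀ {A} → Exhaustible A → ∀ n → Exhaustible (Vec A n)
exhaustible-Vec EA zero    = record { every = λ p → p [] ; every-sound = λ { p h [] → h } }
exhaustible-Vec EA (suc n) = record
  { every       = λ p → every EA λ x → every (exhaustible-Vec EA n) (p ∘ (x ∷_))
  ; every-sound = λ { p h (x ∷ v) → every-sound (exhaustible-Vec EA n) (p ∘ (x ∷_)) (every-sound EA _ h x) v }
  }

exhaustible-Maybe : ∀ {A} → Exhaustible A → Exhaustible (Maybe A)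
exhaustible-Maybe EA = record
  { every       = λ p → p nothing ∧ every EA (p ∘ just)
  ; every-sound = sound
  }
  where
  sound : ∀ p → T (p nothing ∧ every EA (p ∘ just)) → ∀ x → T (p x)
  sound p h nothing  = proj₁ (Function.Equivalence.to (Data.Bool.Properties.T-∧ {p nothing}) h)
  sound p h (just x) = every-sound EA (p ∘ just) (proj₂ (to (T-∧ {p nothing}) h)) x

exhaustible-Vecₖ : ∀ n → Exhaustible (Vecₖ n)
exhaustible-Vecₖ = exhaustible-Vec exhaustible-Bool

allVecₖ : ∀ n → (Vecₖ n → Bool) → Bool
allVecₖ n = every (exhaustible-Vecₖ n)

allVecₖ-sound : ∀ n (p : Vecₖ n → Bool) → allVecₖ n p ≡ true → ∀ v → T (p v)
allVecₖ-sound n p h = every-sound (exhaustible-Vecₖ n) p (from T-≡ h)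

⊕-assoc : ∀ (u v w : Vecₖ n) → (u ⊕ v) ⊕ w ≡ u ⊕ (v ⊕ w)
⊕-assoc = zipWith-assoc xor-assoc

⊕-comm : ∀ (u v : Vecₖ n) → u ⊕ v ≡ v ⊕ u
⊕-comm = zipWith-comm xor-comm

⊕-identityˡ : ∀ (v : Vecₖ n) → 𝟎 ⊕ v ≡ v
⊕-identityˡ = zipWith-identityˡ (λ _ → refl)

⊕-identityʳ : ∀ (v : Vecₖ n) → v ⊕ 𝟎 ≡ v
⊕-identityʳ = zipWith-identityʳ xor-identityʳ

⊕-self : ∀ (v : Vecₖ n) → v ⊕ v ≡ 𝟎
⊕-self []      = refl
⊕-self (x ∷ v) = cong₂ _∷_ (xor-same x) (⊕-self v)

⊕-cancelˡ : ∀ (u v : Vecₖ n) → u ⊕ (u ⊕ v) ≡ v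
⊕-cancelˡ u v = begin
  u ⊕ (u ⊕ v)  ≡⟨ ⊕-assoc u u v ⟨
  (u ⊕ u) ⊕ v  ≡⟨ cong (_⊕ v) (⊕-self u) ⟩
  𝟎 ⊕ v        ≡⟨ ⊕-identityˡ v ⟩
  v            ∎
  where open ≡-Reasoning

⊕-cancelʳ : ∀ (u v : Vecₖ n) → (u ⊕ v) ⊕ v ≡ u
⊕-cancelʳ u v = trans (⊕-assoc u v v) (trans (cong (u ⊕_) (⊕-self v)) (⊕-identityʳ u))

⊕≡𝟎⇒≡ : ∀ (u v : Vecₖ n) → u ⊕ v ≡ 𝟎 → u ≡ v
⊕≡𝟎⇒≡ []      []      _ = refl
⊕≡𝟎⇒≡ (x ∷ u) (y ∷ v) e = cong₂ _∷_ (xor≡false (cong Data.Vec.head e)) (⊕≡𝟎⇒≡ u v (cong Data.Vec.tail e))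
  where
  xor≡false : ∀ {a b} → a xor b ≡ false → a ≡ b
  xor≡false {true}  {true}  _ = refl
  xor≡false {false} {false} _ = refl

dot-⊕ʳ : ∀ (r u v : Vecₖ n) → dot r (u ⊕ v) ≡ dot r u xor dot r v
dot-⊕ʳ []      []      []      = refl
dot-⊕ʳ (x ∷ r) (y ∷ u) (z ∷ v) = begin
  (x ∧ (y xor z)) xor dot r (u ⊕ v)                ≡⟨ cong₂ _xor_ (∧-distribˡ-xor x y z) (dot-⊕ʳ r u v) ⟩
  ((x ∧ y) xor (x ∧ z)) xor (dot r u xor dot r v)  ≡⟨ interchange (x ∧ y) (x ∧ z) (dot r u) (dot r v) ⟩
  ((x ∧ y) xor dot r u) xor ((x ∧ z) xor dot r v)  ∎
  where open ≡-Reasoning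

dot-⊕ˡ : ∀ (r s v : Vecₖ n) → dot (r ⊕ s) v ≡ dot r v xor dot s v
dot-⊕ˡ []      []      []      = refl
dot-⊕ˡ (x ∷ r) (y ∷ s) (z ∷ v) = begin
  ((x xor y) ∧ z) xor dot (r ⊕ s) v                ≡⟨ cong₂ _xor_ (∧-distribʳ-xor z x y) (dot-⊕ˡ r s v) ⟩
  ((x ∧ z) xor (y ∧ z)) xor (dot r v xor dot s v)  ≡⟨ interchange (x ∧ z) (y ∧ z) (dot r v) (dot s v) ⟩
  ((x ∧ z) xor dot r v) xor ((y ∧ z) xor dot s v)  ∎
  where open ≡-Reasoning

dot-𝟎ʳ : ∀ (r : Vecₖ n) → dot r 𝟎 ≡ false
dot-𝟎ʳ []      = refl
dot-𝟎ʳ (x ∷ r) = cong₂ _xor_ (∧-zeroʳ x) (dot-𝟎ʳ r)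

dot-𝟎ˡ : ∀ (v : Vecₖ n) → dot 𝟎 v ≡ false
dot-𝟎ˡ []      = refl
dot-𝟎ˡ (x ∷ v) = dot-𝟎ˡ v

unit : Fin n → Vecₖ n
unit zero    = true ∷ 𝟎
unit (suc j) = false ∷ unit j

dot-unitʳ : ∀ (r : Vecₖ n) j → dot r (unit j) ≡ lookup r j
dot-unitʳ (x ∷ r) zero    = trans (cong₂ _xor_ (∧-identityʳ x) (dot-𝟎ʳ r)) (xor-identityʳ x)
dot-unitʳ (x ∷ r) (suc j) rewrite ∧-zeroʳ x = dot-unitʳ r j

dot-unitˡ : ∀ (v : Vecₖ n) j → dot (unit j) v ≡ lookup v j
dot-unitˡ (x ∷ v) zero    = trans (cong (x xor_) (dot-𝟎ˡ v)) (xor-identityʳ x)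
dot-unitˡ (x ∷ v) (suc j) = dot-unitˡ v j

row-Iₘ : ∀ (i : Fin n) → lookup (Iₘ n) i ≡ unit i
row-Iₘ i = trans (lookup∘tabulate _ i) (diagonal i)
  where
  diagonal : ∀ {n} (i : Fin n) → tabulate (λ k → ⌊ i ≟ᶠ k ⌋) ≡ unit i
  diagonal zero    = cong (true ∷_) tabulate-false
    where
    tabulate-false : ∀ {n} → tabulate {n = n} (λ _ → false) ≡ 𝟎
    tabulate-false {zero}  = refl
    tabulate-false {suc n} = cong (false ∷_) tabulate-false
  diagonal (suc i) = cong (false ∷_) (trans (tabulate-cong (⌊suc≟suc⌋ i)) (diagonal i))
    where
    ⌊suc≟suc⌋ : ∀ {n} (i k : Fin n) → ⌊ suc i ≟ᶠ suc k ⌋ ≡ ⌊ i ≟ᶠ k ⌋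
    ⌊suc≟suc⌋ i k with i ≟ᶠ k
    ... | yes _ = refl
    ... | no  _ = refl

lookup-·ᵥ : ∀ (M : Mat n) v i → lookup (M ·ᵥ v) i ≡ dot (lookup M i) v
lookup-·ᵥ M v i = lookup-map i (λ r → dot r v) M

Iₘ-·ᵥ : ∀ (v : Vecₖ n) → Iₘ n ·ᵥ v ≡ v
Iₘ-·ᵥ {n} v = begin
  Iₘ n ·ᵥ v                    ≡⟨ tabulate∘lookup _ ⟨
  tabulate (lookup (Iₘ n ·ᵥ v)) ≡⟨ tabulate-cong entry ⟩
  tabulate (lookup v)          ≡⟨ tabulate∘lookup v ⟩
  v                            ∎
  where
  open ≡-Reasoning
  entry : ∀ i → lookup (Iₘ n ·ᵥ v) i ≡ lookup v i
  entry i = trans (lookup-·ᵥ (Iₘ n) v i) (trans (cong (λ r → dot r v) (row-Iₘ i)) (dot-unitˡ v i))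

·ᵥ-⊕ : ∀ (M : Mat n) u v → M ·ᵥ (u ⊕ v) ≡ (M ·ᵥ u) ⊕ (M ·ᵥ v)
·ᵥ-⊕ M u v = rows M
  where
  rows : ∀ {m} (R : Vec (Vecₖ _) m) →
         map (λ r → dot r (u ⊕ v)) R ≡ map (λ r → dot r u) R ⊕ map (λ r → dot r v) R
  rows []      = refl
  rows (r ∷ R) = cong₂ _∷_ (dot-⊕ʳ r u v) (rows R)

·ᵥ-𝟎 : ∀ (M : Mat n) → M ·ᵥ 𝟎 ≡ 𝟎
·ᵥ-𝟎 {n} M = rows M
  where
  rows : ∀ {m} (R : Vec (Vecₖ n) m) → map (λ r → dot r 𝟎) R ≡ 𝟎
  rows []      = refl
  rows (r ∷ R) = cong₂ _∷_ (dot-𝟎ʳ r) (rows R)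

dot-map-∧ : ∀ x (s v : Vecₖ n) → dot (map (x ∧_) s) v ≡ x ∧ dot s v
dot-map-∧ x []      []      = sym (∧-zeroʳ x)
dot-map-∧ x (a ∷ s) (b ∷ v) = begin
  ((x ∧ a) ∧ b) xor dot (map (x ∧_) s) v  ≡⟨ cong₂ _xor_ (∧-assoc x a b) (dot-map-∧ x s v) ⟩
  (x ∧ (a ∧ b)) xor (x ∧ dot s v)         ≡⟨ ∧-distribˡ-xor x (a ∧ b) (dot s v) ⟨
  x ∧ ((a ∧ b) xor dot s v)               ∎
  where open ≡-Reasoning

-- map (dot r) (transpose N) is the row vector r N
dot-transpose : ∀ (r : Vecₖ m) (N : Vec (Vecₖ k) m) v →
                dot (map (dot r) (transpose N)) v ≡ dot r (map (λ s → dot s v) N)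
dot-transpose {k = k} [] [] v = trans (cong (λ w → dot w v) (map-replicate (dot []) [] k)) (dot-𝟎ˡ v)
dot-transpose (x ∷ r) (s ∷ N) v = begin
  dot (map (dot (x ∷ r)) (replicate _ _∷_ ⊛ s ⊛ transpose N)) v
    ≡⟨ cong (λ w → dot w v) (cons-column s (transpose N)) ⟩
  dot (map (x ∧_) s ⊕ map (dot r) (transpose N)) v
    ≡⟨ dot-⊕ˡ (map (x ∧_) s) (map (dot r) (transpose N)) v ⟩
  dot (map (x ∧_) s) v xor dot (map (dot r) (transpose N)) v
    ≡⟨ cong₂ _xor_ (dot-map-∧ x s v) (dot-transpose r N v) ⟩
  (x ∧ dot s v) xor dot r (map (λ s → dot s v) N)
    ∎
  where
  open ≡-Reasoning
  cons-column : ∀ {k} (s : Vecₖ k) T →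
                map (dot (x ∷ r)) (replicate k _∷_ ⊛ s ⊛ T) ≡ map (x ∧_) s ⊕ map (dot r) T
  cons-column []      []      = refl
  cons-column (a ∷ s) (t ∷ T) = cong (_ ∷_) (cons-column s T)

*ₘ-·ᵥ : ∀ (M N : Mat n) v → (M *ₘ N) ·ᵥ v ≡ M ·ᵥ (N ·ᵥ v)
*ₘ-·ᵥ M N v = rows M
  where
  rows : ∀ {m} (R : Vec (Vecₖ _) m) →
         map (λ r → dot r v) (map (λ r → map (dot r) (transpose N)) R) ≡ map (λ r → dot r (N ·ᵥ v)) R
  rows []      = refl
  rows (r ∷ R) = cong₂ _∷_ (dot-transpose r N v) (rows R)

·ᵥ-inverse : ∀ {M N : Mat n} → N *ₘ M ≡ Iₘ n → ∀ v → N ·ᵥ (M ·ᵥ v) ≡ v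
·ᵥ-inverse {n} {M} {N} NM≡I v = begin
  N ·ᵥ (M ·ᵥ v)  ≡⟨ *ₘ-·ᵥ N M v ⟨
  (N *ₘ M) ·ᵥ v  ≡⟨ cong (_·ᵥ v) NM≡I ⟩
  Iₘ n ·ᵥ v      ≡⟨ Iₘ-·ᵥ v ⟩
  v              ∎
  where open ≡-Reasoning

GL-·ᵥ-≢𝟎 : ∀ {M : Mat n} → IsGL M → ∀ {v} → v ≢ 𝟎 → M ·ᵥ v ≢ 𝟎
GL-·ᵥ-≢𝟎 {M = M} (N , _ , NM≡I) {v} v≢𝟎 Mv≡𝟎 =
  v≢𝟎 (trans (sym (·ᵥ-inverse NM≡I v)) (trans (cong (N ·ᵥ_) Mv≡𝟎) (·ᵥ-𝟎 N)))

fromColumns : (Fin n → Vecₖ n) → Mat n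
fromColumns c = tabulate (λ i → tabulate (λ j → lookup (c j) i))

fromColumns-cong : ∀ {c d : Fin n → Vecₖ n} → (∀ j → c j ≡ d j) → fromColumns c ≡ fromColumns d
fromColumns-cong c≗d = tabulate-cong λ i → tabulate-cong λ j → cong (λ v → lookup v i) (c≗d j)

fromColumns-·ᵥ-unit : ∀ (M : Mat n) → fromColumns (λ j → M ·ᵥ unit j) ≡ M
fromColumns-·ᵥ-unit M = begin
  tabulate (λ i → tabulate (λ j → lookup (M ·ᵥ unit j) i))  ≡⟨ tabulate-cong (λ i → tabulate-cong (entry i)) ⟩
  tabulate (λ i → tabulate (lookup (lookup M i)))           ≡⟨ tabulate-cong (λ i → tabulate∘lookup (lookup M i)) ⟩
  tabulate (lookup M)                                       ≡⟨ tabulate∘lookup M ⟩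
  M                                                         ∎
  where
  open ≡-Reasoning
  entry : ∀ i j → lookup (M ·ᵥ unit j) i ≡ lookup (lookup M i) j
  entry i j = trans (lookup-·ᵥ M (unit j) i) (dot-unitʳ (lookup M i) j)

-- Over F₂ the cofactor signs vanish and an invertible matrix has
-- determinant 1, so the adjugate is the inverse.
adj₄ : Mat 4 → Mat 4
adj₄ M = tabulate λ i → tabulate λ j → det₃ (map (λ r → removeAt r i) (removeAt M j))

InvertedByAdjugate : Mat 4 → Set
InvertedByAdjugate M = M *ₘ adj₄ M ≡ Iₘ 4 × adj₄ M *ₘ M ≡ Iₘ 4

infix 4 _≟ᵛ_
_≟ᵛ_ : ∀ (u v : Vecₖ n) → Dec (u ≡ v)
_≟ᵛ_ = ≡-dec _≟ᵇ_

invertedByAdjugate? : ∀ M → Dec (InvertedByAdjugate M)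
invertedByAdjugate? M = ≡-dec _≟ᵛ_ (M *ₘ adj₄ M) (Iₘ 4) ×-dec ≡-dec _≟ᵛ_ (adj₄ M *ₘ M) (Iₘ 4)

invertedByAdjugate⇒GL : ∀ M → T ⌊ invertedByAdjugate? M ⌋ → IsGL M
invertedByAdjugate⇒GL M h = adj₄ M , toWitness {a? = invertedByAdjugate? M} h

-- inverse of pt on nonzero vectors; 𝟎 is sent to the junk value # 0
point : Vecₖ 4 → Point
point (false ∷ false ∷ false ∷ false ∷ []) = # 0
point (true  ∷ false ∷ false ∷ false ∷ []) = # 0
point (false ∷ true  ∷ false ∷ false ∷ []) = # 1
point (true  ∷ true  ∷ false ∷ false ∷ []) = # 2
point (false ∷ false ∷ true  ∷ false ∷ []) = # 3
point (true  ∷ false ∷ true  ∷ false ∷ []) = # 4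
point (false ∷ true  ∷ true  ∷ false ∷ []) = # 5
point (true  ∷ true  ∷ true  ∷ false ∷ []) = # 6
point (false ∷ false ∷ false ∷ true  ∷ []) = # 7
point (true  ∷ false ∷ false ∷ true  ∷ []) = # 8
point (false ∷ true  ∷ false ∷ true  ∷ []) = # 9
point (true  ∷ true  ∷ false ∷ true  ∷ []) = # 10
point (false ∷ false ∷ true  ∷ true  ∷ []) = # 11
point (true  ∷ false ∷ true  ∷ true  ∷ []) = # 12
point (false ∷ true  ∷ true  ∷ true  ∷ []) = # 13
point (true  ∷ true  ∷ true  ∷ true  ∷ []) = # 14

point-pt : ∀ p → point (pt p) ≡ p
point-pt = from-yes (all? λ p → point (pt p) ≟ᶠ p)

pt-injective : ∀ {p q} → pt p ≡ pt q → p ≡ q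
pt-injective {p} {q} e = trans (sym (point-pt p)) (trans (cong point e) (point-pt q))

pt≢𝟎 : ∀ p → pt p ≢ 𝟎
pt≢𝟎 = from-yes (all? λ p → ¬? (pt p ≟ᵛ 𝟎))

pt-point : ∀ {v} → v ≢ 𝟎 → pt (point v) ≡ v
pt-point {v} v≢𝟎 = toWitness {a? = pt (point v) ≟ᵛ v}
  (T-∨-elimˡ (allVecₖ-sound 4 check refl v) (v≢𝟎 ∘ toWitness {a? = v ≟ᵛ 𝟎}))
  where
  check : Vecₖ 4 → Bool
  check v = ⌊ v ≟ᵛ 𝟎 ⌋ ∨ ⌊ pt (point v) ≟ᵛ v ⌋

_+ₚ_ : Point → Point → Point
p +ₚ q = point (pt p ⊕ pt q)

pt-+ₚ : ∀ {p q} → p ≢ q → pt (p +ₚ q) ≡ pt p ⊕ pt q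
pt-+ₚ {p} {q} p≢q = pt-point (p≢q ∘ pt-injective ∘ ⊕≡𝟎⇒≡ (pt p) (pt q))

image : Mat 4 → Point → Point
image M p = point (M ·ᵥ pt p)

pt-image : ∀ {M} → IsGL M → ∀ p → pt (image M p) ≡ M ·ᵥ pt p
pt-image gl p = pt-point (GL-·ᵥ-≢𝟎 gl (pt≢𝟎 p))

-- the points 1, 2, 4, 8: the frame contained in all four representatives
basis : Fin 4 → Point
basis j = point (unit j)

pt-basis : ∀ j → pt (basis j) ≡ unit j
pt-basis = from-yes (all? λ j → pt (basis j) ≟ᵛ unit j)

frame : (Fin 4 → Point) → Mat 4
frame f = fromColumns (pt ∘ f)

GL≡frame-image : ∀ {M} → IsGL M → M ≡ frame (image M ∘ basis)
GL≡frame-image {M} gl = begin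
  M                                          ≡⟨ fromColumns-·ᵥ-unit M ⟨
  fromColumns (λ j → M ·ᵥ unit j)            ≡⟨ fromColumns-cong column ⟩
  fromColumns (λ j → pt (image M (basis j))) ∎
  where
  open ≡-Reasoning
  column : ∀ j → M ·ᵥ unit j ≡ pt (image M (basis j))
  column j = trans (cong (M ·ᵥ_) (sym (pt-basis j))) (sym (pt-image gl (basis j)))

Transports : Mat 4 → Subset 15 → Subset 15 → Set
Transports M S T = ∀ p → lookup S p ≡ lookup T (image M p)

∈⇔∈⇒lookup≡ : ∀ {S T : Subset 15} {p q} → (p ∈ S → q ∈ T) → (q ∈ T → p ∈ S) → lookup S p ≡ lookup T q
∈⇔∈⇒lookup≡ {S} {T} {p} {q} to from with lookup S p in sp | lookup T q in tq
... | true  | true  = refl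
... | false | false = refl
... | true  | false = trans (sym ([]=⇒lookup (to (lookup⇒[]= p S sp)))) tq
... | false | true  = trans (sym sp) ([]=⇒lookup (from (lookup⇒[]= q T tq)))

mapsOnto⇔transports : ∀ {M S T} → IsGL M → MapsOnto M S T ⇔ Transports M S T
mapsOnto⇔transports {M} {S} {T} gl = mk⇔ forth back
  where
  forth : MapsOnto M S T → Transports M S T
  forth mo p = let (s→t , t→s) = mo p (image M p) (pt-image gl p) in ∈⇔∈⇒lookup≡ s→t t→s
  back : Transports M S T → MapsOnto M S T
  back tr p q e = (λ p∈S → lookup⇒[]= q T (trans (sym Sp≡Tq) ([]=⇒lookup p∈S)))
                , (λ q∈T → lookup⇒[]= p S (trans Sp≡Tq ([]=⇒lookup q∈T)))
    where
    Sp≡Tq : lookup S p ≡ lookup T q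
    Sp≡Tq = trans (tr p) (cong (lookup T) (pt-injective (trans (pt-image gl p) (sym e))))

mapsOnto-inverse : ∀ {M N S T} → M *ₘ N ≡ Iₘ 4 → MapsOnto M S T → MapsOnto N T S
mapsOnto-inverse {M} {N} MN≡I mo p q e = swap (mo q p (sym (trans (cong (M ·ᵥ_) e) (·ᵥ-inverse MN≡I (pt p)))))

∈⇒T : ∀ {n} {S : Subset n} {p} → p ∈ S → T (lookup S p)
∈⇒T p∈S = from T-≡ ([]=⇒lookup p∈S)

T⇒∈ : ∀ {n} {S : Subset n} {p} → T (lookup S p) → p ∈ S
T⇒∈ {S = S} {p} h = lookup⇒[]= p S (to T-≡ h)

∉⇒¬T : ∀ {n} {S : Subset n} {p} → p ∉ S → ¬ T (lookup S p)
∉⇒¬T p∉S = p∉S ∘ T⇒∈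

x∉p-x : ∀ {n} (S : Subset n) x → x ∉ S - x
x∉p-x (_ ∷ S) zero    ()
x∉p-x (_ ∷ S) (suc x) (there x∈S-x) = x∉p-x S x x∈S-x

p-x≢⊤ : ∀ {n} (S : Subset n) x → S - x ≢ ⊤
p-x≢⊤ S x S-x≡⊤ = x∉p-x S x (subst (x ∈_) (sym S-x≡⊤) ∈⊤)

∣p-x∣+1≡∣p∣ : ∀ {n} {S : Subset n} {x} → x ∈ S → suc ∣ S - x ∣ ≡ ∣ S ∣
∣p-x∣+1≡∣p∣ {S = inside ∷ S}  here        = cong (suc ∘ ∣_∣) (p─⊥≡p S)
∣p-x∣+1≡∣p∣ {S = inside ∷ S}  (there x∈S) = cong suc (∣p-x∣+1≡∣p∣ x∈S)
∣p-x∣+1≡∣p∣ {S = outside ∷ S} (there x∈S) = ∣p-x∣+1≡∣p∣ x∈S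

⊆∧≢⇒∃∉ : ∀ {n} {S T : Subset n} → S ⊆ T → S ≢ T → ∃[ x ] (x ∈ T × x ∉ S)
⊆∧≢⇒∃∉ {n} {S} {T} S⊆T S≢T with all? (λ x → x ∈? T →-dec x ∈? S)
... | yes T⊆S = contradiction (⊆-antisym S⊆T (T⊆S _)) S≢T
... | no  T⊈S with ¬∀⟶∃¬ n _ (λ x → x ∈? T →-dec x ∈? S) T⊈S
...   | x , x∈T↛x∈S = x , x∈T , x∈T↛x∈S ∘ const
  where
  const : x ∈ S → x ∈ T → x ∈ S
  const x∈S _ = x∈S
  x∈T : x ∈ T
  x∈T = decidable-stable (x ∈? T) λ x∉T → x∈T↛x∈S λ x∈T → contradiction x∈T x∉T

Covered : Subset 15 → Point → Set
Covered S p = ∃[ x ] (x ∈ S × p +ₚ x ∈ S)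

-- p = x + y iff y = p + x, the third point of the line through p and x.
saturating⇔covered : ∀ {S} → Saturating1 S ⇔ (S ≢ ⊤ × ∀ p → p ∉ S → Covered S p)
saturating⇔covered {S} = mk⇔ (λ (S≢⊤ , sums) → S≢⊤ , λ p p∉S → covered p (sums p p∉S))
                             (λ (S≢⊤ , cov) → S≢⊤ , λ p p∉S → sum p p∉S (cov p p∉S))
  where
  covered : ∀ p → ∃[ x ] ∃[ y ] (x ∈ S × y ∈ S × x ≢ y × pt p ≡ pt x ⊕ pt y) → Covered S p
  covered p (x , y , x∈S , y∈S , _ , p≡x+y) = x , x∈S , subst (_∈ S) (sym p+x≡y) y∈S
    where
    p+x≡y : p +ₚ x ≡ y
    p+x≡y = begin
      point (pt p ⊕ pt x)          ≡⟨ cong (λ v → point (v ⊕ pt x)) p≡x+y ⟩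
      point ((pt x ⊕ pt y) ⊕ pt x) ≡⟨ cong (λ v → point (v ⊕ pt x)) (⊕-comm (pt x) (pt y)) ⟩
      point ((pt y ⊕ pt x) ⊕ pt x) ≡⟨ cong point (⊕-cancelʳ (pt y) (pt x)) ⟩
      point (pt y)                 ≡⟨ point-pt y ⟩
      y                            ∎
      where open ≡-Reasoning
  sum : ∀ p → p ∉ S → Covered S p → ∃[ x ] ∃[ y ] (x ∈ S × y ∈ S × x ≢ y × pt p ≡ pt x ⊕ pt y)
  sum p p∉S (x , x∈S , p+x∈S) = x , p +ₚ x , x∈S , p+x∈S , x≢p+x , p≡x+[p+x]
    where
    p≡x+[p+x] : pt p ≡ pt x ⊕ pt (p +ₚ x)
    p≡x+[p+x] = sym (begin
      pt x ⊕ pt (p +ₚ x)     ≡⟨ cong (pt x ⊕_) (pt-+ₚ (λ p≡x → p∉S (subst (_∈ S) (sym p≡x) x∈S))) ⟩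
      pt x ⊕ (pt p ⊕ pt x)   ≡⟨ cong (pt x ⊕_) (⊕-comm (pt p) (pt x)) ⟩
      pt x ⊕ (pt x ⊕ pt p)   ≡⟨ ⊕-cancelˡ (pt x) (pt p) ⟩
      pt p                   ∎)
      where open ≡-Reasoning
    x≢p+x : x ≢ p +ₚ x
    x≢p+x x≡p+x = pt≢𝟎 p (trans p≡x+[p+x] (trans (cong (λ z → pt x ⊕ pt z) (sym x≡p+x)) (⊕-self (pt x))))

saturating-⊆ : ∀ {S T} → S ⊆ T → T ≢ ⊤ → Saturating1 S → Saturating1 T
saturating-⊆ S⊆T T≢⊤ (_ , sums) = T≢⊤ , λ p p∉T →
  let (x , y , x∈S , y∈S , x≢y , p≡x+y) = sums p (p∉T ∘ S⊆T) in x , y , S⊆T x∈S , S⊆T y∈S , x≢y , p≡x+y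

Removable : Subset 15 → Set
Removable S = ∃[ x ] (x ∈ S × Saturating1 (S - x))

minimal⇔ : ∀ {S} → MinimalSaturating1 S ⇔ (Saturating1 S × ¬ Removable S)
minimal⇔ {S} = mk⇔ (λ (sat , minimal) → sat , minimal⇒¬removable minimal)
                   (λ (sat , ¬removable) → sat , λ T T⊆S ∣T∣+1≡∣S∣ sat-T → ¬removable (removal T T⊆S ∣T∣+1≡∣S∣ sat-T))
  where
  minimal⇒¬removable : (∀ T → T ⊆ S → suc ∣ T ∣ ≡ ∣ S ∣ → ¬ Saturating1 T) → ¬ Removable S
  minimal⇒¬removable minimal (x , x∈S , sat-x) = minimal (S - x) (p─q⊆p S ⁅ x ⁆) (∣p-x∣+1≡∣p∣ x∈S) sat-x
  -- T misses some x ∈ S, so T ⊆ S - x, which is then saturating as well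
  removal : ∀ T → T ⊆ S → suc ∣ T ∣ ≡ ∣ S ∣ → Saturating1 T → Removable S
  removal T T⊆S ∣T∣+1≡∣S∣ sat-T with ⊆∧≢⇒∃∉ T⊆S (λ T≡S → 1+n≢n (trans ∣T∣+1≡∣S∣ (cong ∣_∣ (sym T≡S))))
  ... | x , x∈S , x∉T = x , x∈S , saturating-⊆ T⊆S-x (p-x≢⊤ S x) sat-T
    where
    T⊆S-x : T ⊆ S - x
    T⊆S-x y∈T = x∈p∧x≢y⇒x∈p-y (T⊆S y∈T) λ y≡x → x∉T (subst (_∈ T) y≡x y∈T)

collinear? : ∀ x y z → Dec (Collinear x y z)
collinear? x y z = ¬? (x ≟ᶠ y) ×-dec ¬? (y ≟ᶠ z) ×-dec ¬? (x ≟ᶠ z) ×-dec (pt x ⊕ pt y) ⊕ pt z ≟ᵛ 𝟎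

hasCollinearTriple? : ∀ S → Dec (HasCollinearTriple S)
hasCollinearTriple? S = any? λ x → any? λ y → any? λ z → x ∈? S ×-dec y ∈? S ×-dec z ∈? S ×-dec collinear? x y z

saturating-cap-complete : ∀ {K} → Saturating1 K → IsCap K → IsCompleteCap K
saturating-cap-complete {K} (_ , sums) cap = cap , λ T K⊆T T≢K cap-T →
  let (p , p∈T , p∉K) = ⊆∧≢⇒∃∉ K⊆T (T≢K ∘ sym)
      (x , y , x∈K , y∈K , x≢y , p≡x+y) = sums p p∉K
      outside : ∀ {z} → z ∈ K → z ≢ p
      outside z∈K z≡p = p∉K (subst (_∈ K) z≡p z∈K)
  in cap-T (x , y , p , K⊆T x∈K , K⊆T y∈K , p∈T , x≢y , outside y∈K , outside x∈K ,
            trans (cong ((pt x ⊕ pt y) ⊕_) p≡x+y) (⊕-self (pt x ⊕ pt y)))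

frameOf : Point → Point → Point → Point → Fin 4 → Point
frameOf a b c d = lookup (a ∷ b ∷ c ∷ d ∷ [])

frame-frameOf : ∀ f → frame (frameOf (f (# 0)) (f (# 1)) (f (# 2)) (f (# 3))) ≡ frame f
frame-frameOf f = fromColumns-cong column
  where
  column : ∀ j → pt (frameOf (f (# 0)) (f (# 1)) (f (# 2)) (f (# 3)) j) ≡ pt (f j)
  column zero                   = refl
  column (suc zero)             = refl
  column (suc (suc zero))       = refl
  column (suc (suc (suc zero))) = refl

existsIn : Subset 15 → (Point → Bool) → Bool
existsIn S q = anyᶠ 15 λ a → lookup S a ∧ q a

existsIn-sound : ∀ S q → T (existsIn S q) → ∃ λ a → T (q a)
existsIn-sound S q h = let (a , h′) = anyᶠ-sound (λ a → lookup S a ∧ q a) h in a , proj₂ (to T-∧ h′)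

forallIn : Subset 15 → (Point → Bool) → Bool
forallIn S q = allᶠ 15 λ a → not (lookup S a) ∨ q a

forallIn-sound : ∀ S q → T (forallIn S q) → ∀ {a} → a ∈ S → T (q a)
forallIn-sound S q h {a} a∈S = T-not-∨ (allᶠ-sound (λ a → not (lookup S a) ∨ q a) h a) (∈⇒T a∈S)

atFrame : (Mat 4 → Bool) → Point → Point → Point → Point → Bool
atFrame p a b c d = p (frame (frameOf a b c d))

allFramesIn : Subset 15 → (Mat 4 → Bool) → Bool
allFramesIn S p = forallIn S λ a → forallIn S λ b → forallIn S λ c → forallIn S (atFrame p a b c)

allFramesIn-sound : ∀ S p → T (allFramesIn S p) → ∀ f → (∀ j → f j ∈ S) → T (p (frame f))
allFramesIn-sound S p h f f∈S = subst (T ∘ p) (frame-frameOf f) h₄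
  where
  a = f (# 0)
  b = f (# 1)
  c = f (# 2)
  d = f (# 3)
  h₁ : T (forallIn S λ b → forallIn S λ c → forallIn S (atFrame p a b c))
  h₁ = forallIn-sound S (λ a → forallIn S λ b → forallIn S λ c → forallIn S (atFrame p a b c)) h (f∈S (# 0))
  h₂ : T (forallIn S λ c → forallIn S (atFrame p a b c))
  h₂ = forallIn-sound S (λ b → forallIn S λ c → forallIn S (atFrame p a b c)) h₁ (f∈S (# 1))
  h₃ : T (forallIn S (atFrame p a b c))
  h₃ = forallIn-sound S (λ c → forallIn S (atFrame p a b c)) h₂ (f∈S (# 2))
  h₄ : T (atFrame p a b c d)
  h₄ = forallIn-sound S (atFrame p a b c) h₃ (f∈S (# 3))

agreesᵇ : Mat 4 → Subset 15 → Subset 15 → Point → Bool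
agreesᵇ M S S′ p = ⌊ lookup S p ≟ᵇ lookup S′ (image M p) ⌋

transportsᵇ : Mat 4 → Subset 15 → Subset 15 → Bool
transportsᵇ M S S′ = allᶠ 15 (agreesᵇ M S S′)

transports⇔ : ∀ {M S S′} → Transports M S S′ ⇔ T (transportsᵇ M S S′)
transports⇔ {M} {S} {S′} = mk⇔ (λ tr → allᶠ-complete (agreesᵇ M S S′) (λ p → fromWitness (tr p)))
                               (λ h p → toWitness (allᶠ-sound (agreesᵇ M S S′) h p))

basis∈rep : ∀ i j → basis j ∈ rep i
basis∈rep = from-yes (all? λ i → all? λ j → basis j ∈? rep i)

everyMapᵇ : Subset 15 → Subset 15 → (Mat 4 → Bool) → Bool
everyMapᵇ K S p = allFramesIn S λ F → not (transportsᵇ F K S) ∨ p F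

-- A map of K onto S is the frame of the images of 1, 2, 4, 8, which lie in S.
everyMap-sound : ∀ K S p → (∀ j → basis j ∈ K) → T (everyMapᵇ K S p) → ∀ M → IsGL M → MapsOnto M K S → T (p M)
everyMap-sound K S p basis∈K h M gl mo = subst (T ∘ p) (sym M≡F)
  (T-not-∨ {transportsᵇ (frame f) K S} (allFramesIn-sound S mapᵇ h f f∈S) (to (transports⇔ {frame f} {K} {S}) tr))
  where
  mapᵇ : Mat 4 → Bool
  mapᵇ F = not (transportsᵇ F K S) ∨ p F
  f : Fin 4 → Point
  f = image M ∘ basis
  M≡F : M ≡ frame f
  M≡F = GL≡frame-image gl
  f∈S : ∀ j → f j ∈ S
  f∈S j = proj₁ (mo (basis j) (f j) (pt-image gl (basis j))) (basis∈K j)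
  tr : Transports (frame f) K S
  tr = subst (λ X → Transports X K S) M≡F (to (mapsOnto⇔transports {M} {K} {S} gl) mo)

carriesᵇ : Subset 15 → Subset 15 → Mat 4 → Bool
carriesᵇ K S M = transportsᵇ M K S ∧ ⌊ invertedByAdjugate? M ⌋

carries⇒projEquiv : ∀ {K S} M → T (carriesᵇ K S M) → ProjEquiv S K
carries⇒projEquiv {K} {S} M h =
  let (transports , inverted) = to (T-∧ {transportsᵇ M K S} {⌊ invertedByAdjugate? M ⌋}) h
      gl@(N , M·N≡I , N·M≡I) = invertedByAdjugate⇒GL M inverted
      maps = from (mapsOnto⇔transports {M} {K} {S} gl) (from (transports⇔ {M} {K} {S}) transports)
  in N , (M , N·M≡I , M·N≡I) , mapsOnto-inverse {M} {N} {K} {S} M·N≡I maps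

inequivalentᵇ : Fin 4 → Fin 4 → Bool
inequivalentᵇ i j = ⌊ i ≟ᶠ j ⌋ ∨ everyMapᵇ (rep i) (rep j) (λ _ → false)

equivalent-reps-equal : (allᶠ 4 λ i → allᶠ 4 (inequivalentᵇ i)) ≡ true → ∀ i j → ProjEquiv (rep i) (rep j) → i ≡ j
equivalent-reps-equal check i j (M , gl , mo) = decidable-stable (i ≟ᶠ j) λ i≢j →
  everyMap-sound (rep i) (rep j) (λ _ → false) (basis∈rep i) (T-∨-elimˡ (at i j) (i≢j ∘ toWitness)) M gl mo
  where
  at : ∀ i j → T (inequivalentᵇ i j)
  at i = allᶠ-sound (inequivalentᵇ i) (allᶠ-sound (λ i → allᶠ 4 (inequivalentᵇ i)) (from T-≡ check) i)

ValidSize : ℕ → Set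
ValidSize k = k ≡ 5 ⊎ k ≡ 6 ⊎ k ≡ 8

validSize? : ∀ k → Dec (ValidSize k)
validSize? k = k ≟ℕ 5 ⊎-dec k ≟ℕ 6 ⊎-dec k ≟ℕ 8

-- Only the last conjunct matters for soundness; the others prune the
-- search, since a frame carrying K onto S already agrees with K on the
-- points 3, 5, 6, 7 (indices 2, 4, 5, 6) spanned by 1, 2, 4.
module FrameSearch (K S : Subset 15) where
  agrees : Point → Point → Bool
  agrees p q = ⌊ lookup K p ≟ᵇ lookup S q ⌋

  level₄ : Point → Point → Point → Point → Bool
  level₄ a b c d = carriesᵇ K S (frame (frameOf a b c d))

  level₃ : Point → Point → Point → Bool
  level₃ a b c = agrees (# 4) (a +ₚ c) ∧ agrees (# 5) (b +ₚ c) ∧ agrees (# 6) ((a +ₚ b) +ₚ c) ∧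
                 existsIn S (level₄ a b c)

  level₂ : Point → Point → Bool
  level₂ a b = agrees (# 2) (a +ₚ b) ∧ existsIn S (level₃ a b)

  carriedFrameᵇ : Bool
  carriedFrameᵇ = existsIn S λ a → existsIn S (level₂ a)

  carriedFrameᵇ-sound : T carriedFrameᵇ → ∃[ f ] T (carriesᵇ K S (frame f))
  carriedFrameᵇ-sound h₀ =
    let (a , h₁) = existsIn-sound S (λ a → existsIn S (level₂ a)) h₀
        (b , h₂) = existsIn-sound S (level₂ a) h₁
        (c , h₃) = existsIn-sound S (level₃ a b) (second (agrees (# 2) (a +ₚ b)) h₂)
        (d , h₄) = existsIn-sound S (level₄ a b c)
                     (second (agrees (# 6) ((a +ₚ b) +ₚ c)) (second (agrees (# 5) (b +ₚ c))
                       (second (agrees (# 4) (a +ₚ c)) h₃)))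
    in frameOf a b c d , h₄
    where
    second : ∀ x {y} → T (x ∧ y) → T y
    second x {y} = proj₂ ∘ to (T-∧ {x} {y})

open FrameSearch using (carriedFrameᵇ; carriedFrameᵇ-sound)

ofSize : Subset 15 → Fin 4 → Bool
ofSize S i = ⌊ ∣ S ∣ ≟ℕ ∣ rep i ∣ ⌋

classifiedᵇ : Subset 15 → Bool
classifiedᵇ S = ⌊ validSize? ∣ S ∣ ⌋ ∧ anyᶠ 4 (λ i → ofSize S i ∧ carriedFrameᵇ (rep i) S)

classifiedᵇ-sound : ∀ S → T (classifiedᵇ S) → ValidSize ∣ S ∣ × ∃[ i ] ProjEquiv S (rep i)
classifiedᵇ-sound S h =
  let (valid , some-i) = to (T-∧ {⌊ validSize? ∣ S ∣ ⌋} {anyᶠ 4 (λ i → ofSize S i ∧ carriedFrameᵇ (rep i) S)}) h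
  in toWitness {a? = validSize? ∣ S ∣} valid , equivalent (anyᶠ-sound (λ i → ofSize S i ∧ carriedFrameᵇ (rep i) S) some-i)
  where
  equivalent : (∃ λ i → T (ofSize S i ∧ carriedFrameᵇ (rep i) S)) → ∃[ i ] ProjEquiv S (rep i)
  equivalent (i , h) = i , carried (carriedFrameᵇ-sound (rep i) S (proj₂ (to (T-∧ {ofSize S i}) h)))
    where
    carried : ∃[ f ] T (carriesᵇ (rep i) S (frame f)) → ProjEquiv S (rep i)
    carried (f , carries) = carries⇒projEquiv (frame f) carries

additionTable : Vec (Vec Point 15) 15
additionTable = tabulate λ p → tabulate (p +ₚ_)

lookup-additionTable : ∀ p x → lookup (lookup additionTable p) x ≡ p +ₚ x
lookup-additionTable p x =
  trans (cong (λ row → lookup row x) (lookup∘tabulate (λ p → tabulate (p +ₚ_)) p)) (lookup∘tabulate (p +ₚ_) x)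

-- The checks are Bool-valued rather than Dec-valued, traverse S alongside
-- the rows of the addition table, and take the table as a parameter so
-- that it is computed only once: they are run on all 2¹⁵ subsets.
module SaturationChecks (sums : Vec (Vec Point 15) 15) (lookup-sums : ∀ p x → lookup (lookup sums p) x ≡ p +ₚ x) where

  hitᵇ : Subset 15 → Bool → Point → Bool
  hitᵇ S s y = s ∧ lookup S y

  coveredᵇ : Subset 15 → Vec Point 15 → Bool
  coveredᵇ S row = anyᵛ (zipWith (hitᵇ S) S row)

  covered⇔ : ∀ {S p} → Covered S p ⇔ T (coveredᵇ S (lookup sums p))
  covered⇔ {S} {p} = mk⇔
    (λ (x , x∈S , p+x∈S) → anyᵛ-complete x (subst T (sym (lookup-zipWith (hitᵇ S) x S (lookup sums p)))
       (from T-∧ (∈⇒T x∈S , subst (T ∘ lookup S) (sym (lookup-sums p x)) (∈⇒T p+x∈S)))))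
    (λ h → let (x , h′) = anyᵛ-sound h
               (x∈S , p+x∈S) = to T-∧ (subst T (lookup-zipWith (hitᵇ S) x S (lookup sums p)) h′)
           in x , T⇒∈ x∈S , T⇒∈ (subst (T ∘ lookup S) (lookup-sums p x) p+x∈S))

  inside-or-coveredᵇ : Subset 15 → Bool → Vec Point 15 → Bool
  inside-or-coveredᵇ S s row = s ∨ coveredᵇ S row

  satᵇ : Subset 15 → Bool
  satᵇ S = allᵛ (zipWith (inside-or-coveredᵇ S) S sums)

  saturating⇔satᵇ : ∀ {S} → S ≢ ⊤ → Saturating1 S ⇔ T (satᵇ S)
  saturating⇔satᵇ {S} S≢⊤ = mk⇔
    (λ sat → allᵛ-complete λ p → subst T (sym (at p)) (inside-or-covered (proj₂ (to saturating⇔covered sat)) p))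
    (λ h → from saturating⇔covered (S≢⊤ , λ p p∉S →
       from (covered⇔ {S} {p}) (T-∨-elimˡ (subst T (at p) (allᵛ-sound h p)) (∉⇒¬T p∉S))))
    where
    at : ∀ p → lookup (zipWith (inside-or-coveredᵇ S) S sums) p ≡ lookup S p ∨ coveredᵇ S (lookup sums p)
    at p = lookup-zipWith (inside-or-coveredᵇ S) p S sums
    inside-or-covered : (∀ p → p ∉ S → Covered S p) → ∀ p → T (lookup S p ∨ coveredᵇ S (lookup sums p))
    inside-or-covered cov p with lookup S p in eq
    ... | true  = tt
    ... | false = to (covered⇔ {S} {p}) (cov p λ p∈S → contradiction (trans (sym ([]=⇒lookup p∈S)) eq) λ ())

  removalᵇ : Subset 15 → Point → Bool
  removalᵇ S x = lookup S x ∧ satᵇ (S - x)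

  removableᵇ : Subset 15 → Bool
  removableᵇ S = anyᶠ 15 (removalᵇ S)

  removable⇔ : ∀ {S} → Removable S ⇔ T (removableᵇ S)
  removable⇔ {S} = mk⇔
    (λ (x , x∈S , sat) → anyᶠ-complete (removalᵇ S) x (from T-∧ (∈⇒T x∈S , to (saturating⇔satᵇ (p-x≢⊤ S x)) sat)))
    (λ h → let (x , h′) = anyᶠ-sound (removalᵇ S) h ; (x∈S , sat) = to T-∧ h′ in
           x , T⇒∈ x∈S , from (saturating⇔satᵇ (p-x≢⊤ S x)) sat)

  minimal-reflect : ∀ {S} → S ≢ ⊤ → satᵇ S ≡ true → removableᵇ S ≡ false → MinimalSaturating1 S
  minimal-reflect {S} S≢⊤ sat ¬removable = from minimal⇔
    (from (saturating⇔satᵇ S≢⊤) (from T-≡ sat) , T-not⇒¬T {removableᵇ S} (from T-not-≡ ¬removable) ∘ to (removable⇔ {S}))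

  classifyᵇ : Subset 15 → Bool
  classifyᵇ S = not (satᵇ S) ∨ removableᵇ S ∨ classifiedᵇ S

  minimal⇒classified : ∀ {S} → T (classifyᵇ S) → MinimalSaturating1 S → ValidSize ∣ S ∣ × ∃[ i ] ProjEquiv S (rep i)
  minimal⇒classified {S} check minimal =
    let (sat , ¬removable) = to minimal⇔ minimal
        sat-holds = to (saturating⇔satᵇ (proj₁ sat)) sat
    in classifiedᵇ-sound S (T-∨-elimˡ (T-not-∨ {satᵇ S} check sat-holds) (¬removable ∘ from (removable⇔ {S})))

open SaturationChecks additionTable lookup-additionTable public

-- An action of G on a set X embedded in F₂⁴, through which a stabiliser
-- is identified with G: a matrix corresponds to the element it induces on X.
record Action (G : ConcreteGroup) : Set₁ where
  open ConcreteGroup G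
  field
    X          : Set
    exhaustX   : Exhaustible X
    emb        : X → Vecₖ 4
    decode     : Vecₖ 4 → X
    decode-emb : ∀ x → decode (emb x) ≡ x
    act        : Carrier → X → X
    act-∙      : ∀ g h x → act (g ∙ h) x ≡ act g (act h x)
    act-cong   : ∀ {g h} → g ≈ h → ∀ x → act g x ≡ act h x
    read       : (X → X) → Carrier
    read-act   : ∀ {f} g → (∀ x → f x ≡ act g x) → read f ≈ g
    frameX     : Fin 4 → X
    emb-frameX : ∀ j → emb (frameX j) ≡ unit j
    mem?       : ∀ g → Dec (Mem g)
    Mem-cong   : ∀ {g h} → g ≈ h → Mem h → Mem g
    everyᴳ       : (Carrier → Bool) → Bool
    everyᴳ-sound : ∀ p → T (everyᴳ p) → ∀ g → ∃[ c ] (c ≈ g × T (p c))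

module _ {G : ConcreteGroup} (A : Action G) where
  open ConcreteGroup G
  open Action A

  Realises : Mat 4 → Carrier → Set
  Realises M g = ∀ x → M ·ᵥ emb x ≡ emb (act g x)

  realisesᵇ : Mat 4 → Carrier → Bool
  realisesᵇ M g = every exhaustX λ x → ⌊ M ·ᵥ emb x ≟ᵛ emb (act g x) ⌋

  realisesᵇ-sound : ∀ M g → T (realisesᵇ M g) → Realises M g
  realisesᵇ-sound M g h x = toWitness (every-sound exhaustX (λ x → ⌊ M ·ᵥ emb x ≟ᵛ emb (act g x) ⌋) h x)

  toᴳ : Mat 4 → Carrier
  toᴳ M = read λ x → decode (M ·ᵥ emb x)

  fromᴳ : Carrier → Mat 4
  fromᴳ g = fromColumns λ j → emb (act g (frameX j))

  realises⇒toᴳ≈ : ∀ {M g} → Realises M g → toᴳ M ≈ g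
  realises⇒toᴳ≈ {M} {g} r = read-act g λ x → trans (cong decode (r x)) (decode-emb (act g x))

  realises-*ₘ : ∀ {M N g h} → Realises M g → Realises N h → Realises (M *ₘ N) (g ∙ h)
  realises-*ₘ {M} {N} {g} {h} rM rN x = begin
    (M *ₘ N) ·ᵥ emb x      ≡⟨ *ₘ-·ᵥ M N (emb x) ⟩
    M ·ᵥ (N ·ᵥ emb x)      ≡⟨ cong (M ·ᵥ_) (rN x) ⟩
    M ·ᵥ emb (act h x)     ≡⟨ rM (act h x) ⟩
    emb (act g (act h x))  ≡⟨ cong emb (act-∙ g h x) ⟨
    emb (act (g ∙ h) x)    ∎
    where open ≡-Reasoning

  realises⇒≡fromᴳ : ∀ {M g} → Realises M g → M ≡ fromᴳ g
  realises⇒≡fromᴳ {M} r = trans (sym (fromColumns-·ᵥ-unit M))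
    (fromColumns-cong λ j → trans (cong (M ·ᵥ_) (sym (emb-frameX j))) (r (frameX j)))

  fromᴳ-cong : ∀ {g h} → g ≈ h → fromᴳ g ≡ fromᴳ h
  fromᴳ-cong g≈h = fromColumns-cong λ j → cong emb (act-cong g≈h (frameX j))

  stabIso-by-action : ∀ {S} → (∀ M → InStab S M → Realises M (toᴳ M) × Mem (toᴳ M)) →
                      (∀ g → Mem g → InStab S (fromᴳ g) × Realises (fromᴳ g) g) → StabIso S G
  stabIso-by-action stab elem = record
    { to      = toᴳ
    ; to-mem  = λ M s → proj₂ (stab M s)
    ; to-hom  = λ M N sM sN → realises⇒toᴳ≈ {M *ₘ N} (realises-*ₘ {M} {N} (proj₁ (stab M sM)) (proj₁ (stab N sN)))
    ; to-inj  = λ M N sM sN e → trans (realises⇒≡fromᴳ {M} (proj₁ (stab M sM)))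
                                  (trans (fromᴳ-cong e) (sym (realises⇒≡fromᴳ {N} (proj₁ (stab N sN)))))
    ; to-surj = λ g m → fromᴳ g , proj₁ (elem g m) , realises⇒toᴳ≈ {fromᴳ g} {g} (proj₂ (elem g m))
    }

  stabilisingᵇ : Mat 4 → Bool
  stabilisingᵇ F = realisesᵇ F (toᴳ F) ∧ ⌊ mem? (toᴳ F) ⌋

  realisedᵇ : Subset 15 → Carrier → Bool
  realisedᵇ S c = transportsᵇ (fromᴳ c) S S ∧ ⌊ invertedByAdjugate? (fromᴳ c) ⌋ ∧ realisesᵇ (fromᴳ c) c

  memberRealisedᵇ : Subset 15 → Carrier → Bool
  memberRealisedᵇ S c = not ⌊ mem? c ⌋ ∨ realisedᵇ S c

  stabiliser-realises : ∀ S → (∀ j → basis j ∈ S) → T (everyMapᵇ S S stabilisingᵇ) →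
                        ∀ M → InStab S M → Realises M (toᴳ M) × Mem (toᴳ M)
  stabiliser-realises S basis∈S check M (gl , mo) =
    let (r , m) = to (T-∧ {realisesᵇ M (toᴳ M)} {⌊ mem? (toᴳ M) ⌋}) (everyMap-sound S S stabilisingᵇ basis∈S check M gl mo)
    in realisesᵇ-sound M (toᴳ M) r , toWitness {a? = mem? (toᴳ M)} m

  realised-by-stabiliser : ∀ S c → T (realisedᵇ S c) → InStab S (fromᴳ c) × Realises (fromᴳ c) c
  realised-by-stabiliser S c h =
    let (tr , rest)   = to (T-∧ {transportsᵇ (fromᴳ c) S S} {⌊ invertedByAdjugate? (fromᴳ c) ⌋ ∧ realisesᵇ (fromᴳ c) c}) h
        (inv , r)     = to (T-∧ {⌊ invertedByAdjugate? (fromᴳ c) ⌋} {realisesᵇ (fromᴳ c) c}) rest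
        gl            = invertedByAdjugate⇒GL (fromᴳ c) inv
    in (gl , from (mapsOnto⇔transports {fromᴳ c} {S} {S} gl) (from (transports⇔ {fromᴳ c} {S} {S}) tr))
     , realisesᵇ-sound (fromᴳ c) c r

  elements-realised : ∀ S → T (everyᴳ (memberRealisedᵇ S)) → ∀ g → Mem g → InStab S (fromᴳ g) × Realises (fromᴳ g) g
  elements-realised S check g m =
    let (c , c≈g , h) = everyᴳ-sound (memberRealisedᵇ S) check g
        (instab , r)  = realised-by-stabiliser S c (T-not-∨ {⌊ mem? c ⌋} {realisedᵇ S c} h (fromWitness (Mem-cong c≈g m)))
    in subst (InStab S) (fromᴳ-cong c≈g) instab
     , λ x → trans (cong (_·ᵥ emb x) (sym (fromᴳ-cong c≈g))) (trans (r x) (cong emb (act-cong c≈g x)))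

  stabIso-reflect : ∀ S → (∀ j → basis j ∈ S) →
                    everyMapᵇ S S stabilisingᵇ ≡ true → everyᴳ (memberRealisedᵇ S) ≡ true → StabIso S G
  stabIso-reflect S basis∈S stab elems =
    stabIso-by-action (stabiliser-realises S basis∈S (from T-≡ stab)) (elements-realised S (from T-≡ elems))

injective? : ∀ {n} (f : Fin n → Fin n) → Dec (Injective _≡_ _≡_ f)
injective? f = map′ (λ inj {x} {y} → inj x y) (λ inj x y → inj {x} {y})
                    (all? λ x → all? λ y → f x ≟ᶠ f y →-dec x ≟ᶠ y)

-- the first index at which e takes the value v (the last index if there is none)
indexOf : ∀ {n} → (Fin (suc n) → Vecₖ 4) → Vecₖ 4 → Fin (suc n)
indexOf {zero}  e v = zero
indexOf {suc n} e v = if ⌊ e zero ≟ᵛ v ⌋ then zero else suc (indexOf (e ∘ suc) v)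

-- K5: a frame of five points, permuted by S₅

k5 : Fin 5 → Point
k5 = lookup (# 0 ∷ # 1 ∷ # 3 ∷ # 7 ∷ # 14 ∷ [])

sym5-action : Action Sym5
sym5-action = record
  { X            = Fin 5
  ; exhaustX     = exhaustible-Fin 5
  ; emb          = pt ∘ k5
  ; decode       = indexOf (pt ∘ k5)
  ; decode-emb   = from-yes (all? λ i → indexOf (pt ∘ k5) (pt (k5 i)) ≟ᶠ i)
  ; act          = λ σ i → σ i
  ; act-∙        = λ _ _ _ → refl
  ; act-cong     = λ σ≈τ → σ≈τ
  ; read         = λ f → f
  ; read-act     = λ _ f≗σ → f≗σ
  ; frameX       = inject₁
  ; emb-frameX   = from-yes (all? λ j → pt (k5 (inject₁ j)) ≟ᵛ unit j)
  ; mem?         = injective?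
  ; Mem-cong     = λ σ≈τ τ-inj σx≡σy → τ-inj (trans (sym (σ≈τ _)) (trans σx≡σy (σ≈τ _)))
  ; everyᴳ       = λ p → every tables (p ∘ lookup)
  ; everyᴳ-sound = λ p h σ → lookup (tabulate σ) , lookup∘tabulate σ , every-sound tables (p ∘ lookup) h (tabulate σ)
  }
  where
  tables : Exhaustible (Vec (Fin 5) 5)
  tables = exhaustible-Vec (exhaustible-Fin 5) 5

-- K6: the two skew lines {1, 2, 3} and {4, 8, 12}

k6 : Bool × Fin 3 → Point
k6 (false , i) = lookup (# 0 ∷ # 1 ∷ # 2 ∷ []) i
k6 (true  , i) = lookup (# 3 ∷ # 7 ∷ # 11 ∷ []) i

-- the index of a point on a line {u, v, u + v}, given its coordinates in u, v
onLine : Bool → Bool → Fin 3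
onLine true  false = # 0
onLine false true  = # 1
onLine _     _     = # 2

decode6 : Vecₖ 4 → Bool × Fin 3
decode6 (a ∷ b ∷ c ∷ d ∷ []) = if c ∨ d then (true , onLine c d) else (false , onLine a b)

act6 : ConcreteGroup.Carrier S3xS3⋊C2 → Bool × Fin 3 → Bool × Fin 3
act6 ((σ₁ , σ₂) , e) (l , i) = l xor e , (if l xor e then σ₂ else σ₁) i

read6 : (Bool × Fin 3 → Bool × Fin 3) → ConcreteGroup.Carrier S3xS3⋊C2
read6 f = ((λ i → proj₂ (f (e , i))) , (λ i → proj₂ (f (not e , i)))) , e
  where e = proj₁ (f (false , zero))

s3xs3⋊c2-action : Action S3xS3⋊C2
s3xs3⋊c2-action = record
  { X            = Bool × Fin 3
  ; exhaustX     = exhaustible-× exhaustible-Bool (exhaustible-Fin 3)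
  ; emb          = pt ∘ k6
  ; decode       = decode6
  ; decode-emb   = λ { (false , zero) → refl ; (false , suc zero) → refl ; (false , suc (suc zero)) → refl
                     ; (true , zero) → refl ; (true , suc zero) → refl ; (true , suc (suc zero)) → refl }
  ; act          = act6
  ; act-∙        = act6-∙
  ; act-cong     = act6-cong
  ; read         = read6
  ; read-act     = λ {f} → read6-act6 {f}
  ; frameX       = frame6
  ; emb-frameX   = from-yes (all? λ j → pt (k6 (frame6 j)) ≟ᵛ unit j)
  ; mem?         = λ { ((σ₁ , σ₂) , _) → injective? σ₁ ×-dec injective? σ₂ }
  ; Mem-cong     = λ { (σ₁≈τ₁ , σ₂≈τ₂ , _) (τ₁-inj , τ₂-inj) →
                       (λ e → τ₁-inj (trans (sym (σ₁≈τ₁ _)) (trans e (σ₁≈τ₁ _))))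
                     , (λ e → τ₂-inj (trans (sym (σ₂≈τ₂ _)) (trans e (σ₂≈τ₂ _)))) }
  ; everyᴳ       = λ p → every tables (p ∘ fromTables)
  ; everyᴳ-sound = λ { p h ((σ₁ , σ₂) , e) →
                       ((lookup (tabulate σ₁) , lookup (tabulate σ₂)) , e)
                     , (lookup∘tabulate σ₁ , lookup∘tabulate σ₂ , refl)
                     , every-sound tables (p ∘ fromTables) h ((tabulate σ₁ , tabulate σ₂) , e) }
  }
  where
  open ConcreteGroup S3xS3⋊C2 using (Carrier; _∙_; _≈_)
  frame6 : Fin 4 → Bool × Fin 3
  frame6 = lookup ((false , # 0) ∷ (false , # 1) ∷ (true , # 0) ∷ (true , # 1) ∷ [])
  fromTables : (Vec (Fin 3) 3 × Vec (Fin 3) 3) × Bool → Carrier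
  fromTables ((t₁ , t₂) , e) = (lookup t₁ , lookup t₂) , e
  tables : Exhaustible ((Vec (Fin 3) 3 × Vec (Fin 3) 3) × Bool)
  tables = exhaustible-× (exhaustible-× S₃-tables S₃-tables) exhaustible-Bool
    where S₃-tables = exhaustible-Vec (exhaustible-Fin 3) 3
  act6-∙ : ∀ g h x → act6 (g ∙ h) x ≡ act6 g (act6 h x)
  act6-∙ (_ , false) (_ , false) (false , i) = refl
  act6-∙ (_ , false) (_ , false) (true  , i) = refl
  act6-∙ (_ , false) (_ , true)  (false , i) = refl
  act6-∙ (_ , false) (_ , true)  (true  , i) = refl
  act6-∙ (_ , true)  (_ , false) (false , i) = refl
  act6-∙ (_ , true)  (_ , false) (true  , i) = refl
  act6-∙ (_ , true)  (_ , true)  (false , i) = refl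
  act6-∙ (_ , true)  (_ , true)  (true  , i) = refl
  act6-cong : ∀ {g h} → g ≈ h → ∀ x → act6 g x ≡ act6 h x
  act6-cong {(_ , e)} (σ₁≈τ₁ , σ₂≈τ₂ , refl) (l , i) with l xor e
  ... | false = cong (false ,_) (σ₁≈τ₁ i)
  ... | true  = cong (true ,_) (σ₂≈τ₂ i)
  read6-act6 : ∀ {f} g → (∀ x → f x ≡ act6 g x) → read6 f ≈ g
  read6-act6 {f} ((σ₁ , σ₂) , e) f≗g = own , other , e′≡e
    where
    e′≡e : proj₁ (f (false , zero)) ≡ e
    e′≡e = cong proj₁ (f≗g (false , zero))
    same : ∀ e i → (if e xor e then σ₂ else σ₁) i ≡ σ₁ i
    same false i = refl
    same true  i = refl
    swapped : ∀ e i → (if not e xor e then σ₂ else σ₁) i ≡ σ₂ i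
    swapped false i = refl
    swapped true  i = refl
    own : ∀ i → proj₂ (f (proj₁ (f (false , zero)) , i)) ≡ σ₁ i
    own i = trans (cong (λ b → proj₂ (f (b , i))) e′≡e) (trans (cong proj₂ (f≗g (e , i))) (same e i))
    other : ∀ i → proj₂ (f (not (proj₁ (f (false , zero))) , i)) ≡ σ₂ i
    other i = trans (cong (λ b → proj₂ (f (not b , i))) e′≡e) (trans (cong proj₂ (f≗g (not e , i))) (swapped e i))

-- K8a: the complement of the plane x₀ + x₁ + x₂ + x₃ = 0, an affine space AG(3,2)

-- u ↦ (u, 1 + u₀ + u₁ + u₂) identifies F₂³ with the points of K8a
affine : Vecₖ 3 → Vecₖ 4
affine (a ∷ b ∷ c ∷ []) = a ∷ b ∷ c ∷ not (a xor b xor c) ∷ []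

asl32-action : Action ASL32
asl32-action = record
  { X            = Vecₖ 3
  ; exhaustX     = exhaustible-Vecₖ 3
  ; emb          = affine
  ; decode       = λ { (a ∷ b ∷ c ∷ _ ∷ []) → a ∷ b ∷ c ∷ [] }
  ; decode-emb   = λ { (a ∷ b ∷ c ∷ []) → refl }
  ; act          = affineMap
  ; act-∙        = affineMap-∙
  ; act-cong     = λ { refl _ → refl }
  ; read         = λ f → fromColumns (λ j → f (unit j) ⊕ f 𝟎) , f 𝟎
  ; read-act     = λ {f} → read-affineMap {f}
  ; frameX       = lookup (unit (# 0) ∷ unit (# 1) ∷ unit (# 2) ∷ 𝟎 ∷ [])
  ; emb-frameX   = λ { zero → refl ; (suc zero) → refl ; (suc (suc zero)) → refl ; (suc (suc (suc zero))) → refl }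
  ; mem?         = λ (A , _) → det₃ A ≟ᵇ true
  ; Mem-cong     = λ { refl m → m }
  ; everyᴳ       = every elements
  ; everyᴳ-sound = λ p h g → g , refl , every-sound elements p h g
  }
  where
  open ConcreteGroup ASL32 using (Carrier; _∙_)
  elements : Exhaustible Carrier
  elements = exhaustible-× (exhaustible-Vec (exhaustible-Vecₖ 3) 3) (exhaustible-Vecₖ 3)
  affineMap : Carrier → Vecₖ 3 → Vecₖ 3
  affineMap (A , b) u = (A ·ᵥ u) ⊕ b
  affineMap-∙ : ∀ g h u → affineMap (g ∙ h) u ≡ affineMap g (affineMap h u)
  affineMap-∙ (A , b) (C , d) u = begin
    ((A *ₘ C) ·ᵥ u) ⊕ ((A ·ᵥ d) ⊕ b)  ≡⟨ ⊕-assoc ((A *ₘ C) ·ᵥ u) (A ·ᵥ d) b ⟨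
    (((A *ₘ C) ·ᵥ u) ⊕ (A ·ᵥ d)) ⊕ b  ≡⟨ cong (λ v → (v ⊕ (A ·ᵥ d)) ⊕ b) (*ₘ-·ᵥ A C u) ⟩
    ((A ·ᵥ (C ·ᵥ u)) ⊕ (A ·ᵥ d)) ⊕ b  ≡⟨ cong (_⊕ b) (·ᵥ-⊕ A (C ·ᵥ u) d) ⟨
    (A ·ᵥ ((C ·ᵥ u) ⊕ d)) ⊕ b         ∎
    where open ≡-Reasoning
  read-affineMap : ∀ {f} g → (∀ u → f u ≡ affineMap g u) → (fromColumns (λ j → f (unit j) ⊕ f 𝟎) , f 𝟎) ≡ g
  read-affineMap {f} (A , b) f≗g = cong₂ _,_ (trans (fromColumns-cong column) (fromColumns-·ᵥ-unit A)) f𝟎≡b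
    where
    f𝟎≡b : f 𝟎 ≡ b
    f𝟎≡b = trans (f≗g 𝟎) (trans (cong (_⊕ b) (·ᵥ-𝟎 A)) (⊕-identityˡ b))
    column : ∀ j → f (unit j) ⊕ f 𝟎 ≡ A ·ᵥ unit j
    column j = trans (cong₂ _⊕_ (f≗g (unit j)) f𝟎≡b) (⊕-cancelʳ (A ·ᵥ unit j) b)

-- K8b: the plane x₁ = 0 together with the point 2

planeOrE₁ : Maybe (Vecₖ 3) → Vecₖ 4
planeOrE₁ nothing                   = unit (# 1)
planeOrE₁ (just (a ∷ b ∷ c ∷ []))   = a ∷ false ∷ b ∷ c ∷ []

psl32-action : Action PSL32
psl32-action = record
  { X            = Maybe (Vecₖ 3)
  ; exhaustX     = exhaustible-Maybe (exhaustible-Vecₖ 3)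
  ; emb          = planeOrE₁
  ; decode       = λ { (_ ∷ true ∷ _ ∷ _ ∷ []) → nothing ; (a ∷ false ∷ c ∷ d ∷ []) → just (a ∷ c ∷ d ∷ []) }
  ; decode-emb   = λ { nothing → refl ; (just (a ∷ b ∷ c ∷ [])) → refl }
  ; act          = λ A → Maybe.map (A ·ᵥ_)
  ; act-∙        = λ { A C nothing → refl ; A C (just u) → cong just (*ₘ-·ᵥ A C u) }
  ; act-cong     = λ { refl _ → refl }
  ; read         = λ f → fromColumns (λ j → fromMaybe 𝟎 (f (just (unit j))))
  ; read-act     = λ {f} A f≗A → trans (fromColumns-cong (λ j → cong (fromMaybe 𝟎) (f≗A (just (unit j)))))
                                       (fromColumns-·ᵥ-unit A)
  ; frameX       = lookup (just (unit (# 0)) ∷ nothing ∷ just (unit (# 1)) ∷ just (unit (# 2)) ∷ [])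
  ; emb-frameX   = λ { zero → refl ; (suc zero) → refl ; (suc (suc zero)) → refl ; (suc (suc (suc zero))) → refl }
  ; mem?         = λ A → det₃ A ≟ᵇ true
  ; Mem-cong     = λ { refl m → m }
  ; everyᴳ       = every (exhaustible-Vec (exhaustible-Vecₖ 3) 3)
  ; everyᴳ-sound = λ p h A → A , refl , every-sound (exhaustible-Vec (exhaustible-Vecₖ 3) 3) p h A
  }

opaque
  unfolding allᵛ

  classification : ∀ S → T (classifyᵇ S)
  classification = allVecₖ-sound 15 classifyᵇ refl

  reps-inequivalent : ∀ i j → ProjEquiv (rep i) (rep j) → i ≡ j
  reps-inequivalent = equivalent-reps-equal refl

  minimal-K5 : MinimalSaturating1 K5
  minimal-K5 = minimal-reflect (λ ()) refl refl
  minimal-K6 : MinimalSaturating1 K6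
  minimal-K6 = minimal-reflect (λ ()) refl refl
  minimal-K8a : MinimalSaturating1 K8a
  minimal-K8a = minimal-reflect (λ ()) refl refl
  minimal-K8b : MinimalSaturating1 K8b
  minimal-K8b = minimal-reflect (λ ()) refl refl
  stabIso-K5 : StabIso K5 Sym5
  stabIso-K5 = stabIso-reflect sym5-action K5 (basis∈rep (# 0)) refl refl

  stabIso-K6 : StabIso K6 S3xS3⋊C2
  stabIso-K6 = stabIso-reflect s3xs3⋊c2-action K6 (basis∈rep (# 1)) refl refl

  stabIso-K8a : StabIso K8a ASL32
  stabIso-K8a = stabIso-reflect asl32-action K8a (basis∈rep (# 2)) refl refl

  stabIso-K8b : StabIso K8b PSL32
  stabIso-K8b = stabIso-reflect psl32-action K8b (basis∈rep (# 3)) refl refl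

mainTheorem2 :
    -- the four sets, with their stated properties and stabilizers
    (MinimalSaturating1 K5 × ∣ K5 ∣ ≡ 5 × IsCompleteCap K5 × StabIso K5 Sym5)
    × (MinimalSaturating1 K6 × ∣ K6 ∣ ≡ 6 × HasCollinearTriple K6 × StabIso K6 S3xS3⋊C2)
    × (MinimalSaturating1 K8a × ∣ K8a ∣ ≡ 8 × IsCompleteCap K8a × StabIso K8a ASL32)
    × (MinimalSaturating1 K8b × ∣ K8b ∣ ≡ 8 × HasCollinearTriple K8b × StabIso K8b PSL32)
    -- every minimal 1-saturating set is projectively equivalent to one of them
    × (∀ (S : Subset 15) → MinimalSaturating1 S → ∃[ i ] ProjEquiv S (rep i))
    -- and they are pairwise projectively inequivalent
    × (∀ (i j : Fin 4) → ProjEquiv (rep i) (rep j) → i ≡ j)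
    -- in particular the sizes are 5, 6 and 8
    × (∀ (S : Subset 15) → MinimalSaturating1 S → ∣ S ∣ ≡ 5 ⊎ ∣ S ∣ ≡ 6 ⊎ ∣ S ∣ ≡ 8)
mainTheorem2 =
    (minimal-K5  , refl , saturating-cap-complete (proj₁ minimal-K5) (from-no (hasCollinearTriple? K5)) , stabIso-K5)
  , (minimal-K6  , refl , from-yes (hasCollinearTriple? K6) , stabIso-K6)
  , (minimal-K8a , refl , saturating-cap-complete (proj₁ minimal-K8a) (from-no (hasCollinearTriple? K8a)) , stabIso-K8a)
  , (minimal-K8b , refl , from-yes (hasCollinearTriple? K8b) , stabIso-K8b)
  , (λ S minimal → proj₂ (classified S minimal))
  , reps-inequivalent
  , (λ S minimal → proj₁ (classified S minimal))
  where
  classified : ∀ S → MinimalSaturating1 S → ValidSize ∣ S ∣ × ∃[ i ] ProjEquiv S (rep i)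
  classified S = minimal⇒classified (classification S)
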